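{- Let $T,S\subseteq\mathbb{Z}_{>0}$ be finite with $T\preceq S$, and let $x$ be an integer with $|T_{<x}|=|S_{\le x}|$. Then for every $j\le|T_{<x}|$ (with $j\ge1$), $(T\triangleleft S)(j)=T(j)$.
   Context: For finite $T,S\subseteq\mathbb{Z}_{>0}$, $T\triangleleft S$ is computed by going through $s\in S$ from largest to smallest; each $s$ picks the largest not-yet-picked $t\in T$ with $t<s$, if one exists; $T\triangleleft S$ is the set of picked elements. $S(i)$ denotes the $i$-th smallest element of $S$; $T_{<x}=\{t\in T:t<x\}$, $S_{\le x}=\{s\in S:s\le x\}$. $T\preceq S$ means $|T|\ge|S|$ and $T(i)<S(i)$ for all $i\in[|S|]$. -}

module Defs where

open import Data.Nat using (ℕ; zero; suc; _<_; _≤_; _≥_; _<?_)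
open import Data.Nat.Properties using (_≟_)
open import Data.Integer as ℤ using (ℤ; +_)
open import Data.List using (List; []; _∷_; length; filter; reverse)
open import Data.List.Relation.Unary.All using (All)
open import Data.List.Relation.Unary.Linked using (Linked)
open import Data.List.Membership.DecPropositional _≟_ using (_∈?_)
open import Relation.Nullary using (yes; no)
open import Data.Maybe using (Maybe; just; nothing)
open import Data.Product using (_×_; _,_; ∃₂)
open import Relation.Binary.PropositionalEquality using (_≡_)

-- A finite subset of ℤ_{>0} is represented by the list of its elements in
-- strictly increasing order (a unique representation).
record IsFinPosSet (S : List ℕ) : Set where
  field
    increasing : Linked _<_ S
    positive   : All (λ s → 1 ≤ s) S

-- S(i): the i-th smallest element (1-indexed); nothing if out of range.
nth : List ℕ → ℕ → Maybe ℕ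
nth []      _             = nothing
nth (s ∷ _) 1             = just s
nth (_ ∷ ss) (suc (suc i)) = nth ss (suc i)
nth (_ ∷ _) zero          = nothing

below : List ℕ → ℤ → List ℕ
below T x = filter (λ t → + t ℤ.<? x) T

atMost : List ℕ → ℤ → List ℕ
atMost S x = filter (λ s → + s ℤ.≤? x) S

_⪯_ : List ℕ → List ℕ → Set
T ⪯ S = (length T ≥ length S)
      × (∀ i → 1 ≤ i → i ≤ length S →
           ∃₂ λ a b → nth T i ≡ just a × nth S i ≡ just b × a < b)

-- From a list of available elements sorted in DECREASING order, remove the
-- first (i.e. largest) element t with t < s, returning it.
pickBelow : ℕ → List ℕ → Maybe ℕ × List ℕ
pickBelow s [] = nothing , []
pickBelow s (t ∷ ts) with t <? s
... | yes _ = just t , ts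
... | no _ with pickBelow s ts
...   | (m , rest) = m , t ∷ rest

-- Process the elements of S in DECREASING order; each picks the largest
-- not-yet-picked available t < s (if any). Returns the picked elements.
matchDesc : List ℕ → List ℕ → List ℕ
matchDesc [] av = []
matchDesc (s ∷ ss) av with pickBelow s av
... | just t  , av' = t ∷ matchDesc ss av'
... | nothing , av' = matchDesc ss av'

_◁_ : List ℕ → List ℕ → List ℕ
T ◁ S = filter (λ t → t ∈? matchDesc (reverse S) (reverse T)) T

{-# OPTIONS --safe #-}
module Submission where

-- Split T = T_{<x} ++ T_{≥x} and S = S_{≤x} ++ S_{>x}. The condition T ⪯ S gives
-- every s ∈ S a partner below it, the partners forming an initial segment of T;
-- since |T_{<x}| = |S_{≤x}|, the partners of S_{≤x} are exactly T_{<x}.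
-- Run the matching from the top: each s ∈ S_{>x} picks something at or above its
-- own partner, so T_{<x} is never reached, and whatever is left over above
-- T_{<x} is ≥ x. Then each s ∈ S_{≤x} skips those leftovers (they are ≥ s)
-- and picks its partner. Hence T_{<x} ⊆ T ◁ S, so T ◁ S begins with T_{<x}.

open import Defs
open import Data.Nat using (ℕ; zero; suc; _≤_; _<_; _>_; z≤n; s≤s; _<?_)
open import Data.Nat.Properties using (<-trans; <⇒≤; <⇒≱; suc-injective)
open import Data.Integer using (ℤ; +_; +<+; +≤+)
import Data.Integer as ℤ
import Data.Integer.Properties as ℤ
open import Data.List using (List; []; _∷_; _++_; length; filter; reverse)
open import Data.List.Properties using (++-assoc; reverse-++; filter-++; filter-all; filter-none; ∷-injective)
open import Data.List.Relation.Unary.All as All using (All; []; _∷_)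
open import Data.List.Relation.Unary.All.Properties using (++⁺; ++⁻; all-filter)
import Data.List.Relation.Unary.Any.Properties as Any
open import Data.List.Relation.Unary.Linked as Linked using (Linked; []; [-]; _∷_)
open import Data.List.Relation.Unary.Linked.Properties using (Linked⇒All)
open import Data.List.Relation.Binary.Pointwise as Pointwise using (Pointwise; []; _∷_; Pointwise-length)
open import Data.List.Membership.Propositional using (_∈_)
open import Data.List.Membership.Propositional.Properties using (∈-++⁺ʳ)
open import Data.Maybe using (just)
open import Data.Product using (_×_; _,_; ∃; ∃₂)
open import Relation.Nullary using (¬_; yes; no; contradiction)
open import Relation.Unary using (Pred; Decidable; ∁)
open import Relation.Binary.PropositionalEquality using (_≡_; refl; sym; trans; cong; cong₂; subst; module ≡-Reasoning)
open ≡-Reasoning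

++-cancel-≡-length : ∀ {a} {A : Set a} (xs ys : List A) {zs ws : List A} →
                     length xs ≡ length ys → xs ++ zs ≡ ys ++ ws → xs ≡ ys × zs ≡ ws
++-cancel-≡-length []       []       _         eq = refl , eq
++-cancel-≡-length (x ∷ xs) (y ∷ ys) |xs|≡|ys| eq with ∷-injective eq
... | refl , eq′ with ++-cancel-≡-length xs ys (suc-injective |xs|≡|ys|) eq′
...   | refl , zs≡ws = refl , zs≡ws

All-reverse⁺ : ∀ {a p} {A : Set a} {P : Pred A p} {xs : List A} → All P xs → All P (reverse xs)
All-reverse⁺ ps = All.tabulate (λ x∈ → All.lookup ps (Any.reverse⁻ x∈))

Pointwise-++⁻ : ∀ {a b r} {A : Set a} {B : Set b} {R : A → B → Set r} xs {ys : List A} {zs : List B} →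
                Pointwise R (xs ++ ys) zs →
                ∃₂ λ zs₁ zs₂ → zs ≡ zs₁ ++ zs₂ × Pointwise R xs zs₁ × Pointwise R ys zs₂
Pointwise-++⁻ []       rs       = [] , _ , refl , [] , rs
Pointwise-++⁻ (x ∷ xs) (r ∷ rs) with Pointwise-++⁻ xs rs
... | zs₁ , zs₂ , refl , rs₁ , rs₂ = _ ∷ zs₁ , zs₂ , refl , r ∷ rs₁ , rs₂

head-<-tail : ∀ {x xs} → Linked _<_ (x ∷ xs) → All (x <_) xs
head-<-tail [-]            = []
head-<-tail (x<y ∷ sorted) = Linked⇒All <-trans x<y sorted

filter-downClosed : ∀ {p} {P : Pred ℕ p} (P? : Decidable P) → (∀ {a b} → a < b → P b → P a) →
                    ∀ {xs} → Linked _<_ xs → ∃ λ ys → xs ≡ filter P? xs ++ ys × All (∁ P) ys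
filter-downClosed P? down {[]}     _      = [] , refl , []
filter-downClosed P? down {x ∷ xs} sorted with P? x
... | no ¬Px = x ∷ xs , cong (_++ x ∷ xs) (sym (filter-none P? ¬Pxs)) , ¬Px ∷ ¬Pxs
  where ¬Pxs = All.map (λ x<y Py → ¬Px (down x<y Py)) (head-<-tail sorted)
... | yes _ with filter-downClosed P? down (Linked.tail sorted)
...   | ys , xs≡ , ¬Pys = ys , cong (x ∷_) xs≡ , ¬Pys

nth-++ˡ : ∀ xs ys {j} → j ≤ length xs → nth (xs ++ ys) j ≡ nth xs j
nth-++ˡ []       []       z≤n      = refl
nth-++ˡ []       (_ ∷ _)  z≤n      = refl
nth-++ˡ (x ∷ xs) ys {zero}        _        = refl
nth-++ˡ (x ∷ xs) ys {1}           _        = refl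
nth-++ˡ (x ∷ xs) ys {suc (suc j)} (s≤s j≤) = nth-++ˡ xs ys j≤

nth-filter-++ : ∀ {p} {P : Pred ℕ p} (P? : Decidable P) xs ys {j} → All P xs → j ≤ length xs →
                nth (filter P? (xs ++ ys)) j ≡ nth (xs ++ ys) j
nth-filter-++ P? xs ys {j} Pxs j≤ = begin
  nth (filter P? (xs ++ ys)) j          ≡⟨ cong (λ zs → nth zs j) (filter-++ P? xs ys) ⟩
  nth (filter P? xs ++ filter P? ys) j  ≡⟨ cong (λ zs → nth (zs ++ filter P? ys) j) (filter-all P? Pxs) ⟩
  nth (xs ++ filter P? ys) j            ≡⟨ nth-++ˡ xs _ j≤ ⟩
  nth xs j                              ≡⟨ nth-++ˡ xs ys j≤ ⟨
  nth (xs ++ ys) j                      ∎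

⪯-∷⁻ : ∀ {t s T S} → (t ∷ T) ⪯ (s ∷ S) → t < s × T ⪯ S
⪯-∷⁻ (s≤s |S|≤|T| , nth<) with nth< 1 (s≤s z≤n) (s≤s z≤n)
... | _ , _ , refl , refl , t<s =
  t<s , |S|≤|T| , λ { (suc i) (s≤s z≤n) i≤ → nth< (suc (suc i)) (s≤s z≤n) (s≤s i≤) }

⪯⇒Pointwise-prefix : ∀ T S → T ⪯ S → ∃₂ λ U D → T ≡ U ++ D × Pointwise _>_ S U
⪯⇒Pointwise-prefix T       []      _        = [] , T , refl , []
⪯⇒Pointwise-prefix []      (s ∷ S) (() , _)
⪯⇒Pointwise-prefix (t ∷ T) (s ∷ S) t∷T⪯s∷S with ⪯-∷⁻ t∷T⪯s∷S
... | t<s , T⪯S with ⪯⇒Pointwise-prefix T S T⪯S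
...   | U , D , refl , S>U = t ∷ U , D , refl , t<s ∷ S>U

pickBelow-past : ∀ {p} (P : Pred ℕ p) {s b} A B → All P A → P b → b < s →
                 ∃₂ λ t A′ → All P A′ × pickBelow s (A ++ b ∷ B) ≡ (just t , A′ ++ B)
pickBelow-past P {s} {b} [] B _ Pb b<s with b <? s
... | yes _   = b , [] , [] , refl
... | no b≮s = contradiction b<s b≮s
pickBelow-past P {s} {b} (a ∷ A) B (Pa ∷ PA) Pb b<s with a <? s
... | yes _ = a , A ++ b ∷ [] , ++⁺ PA (Pb ∷ []) , cong (just a ,_) (sym (++-assoc A (b ∷ []) B))
... | no _ with pickBelow-past P A B PA Pb b<s
...   | t , A′ , PA′ , picked rewrite picked = t , a ∷ A′ , Pa ∷ PA′ , refl

pickBelow-skipping : ∀ {s b} A B → All (s ≤_) A → b < s → pickBelow s (A ++ b ∷ B) ≡ (just b , A ++ B)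
pickBelow-skipping {s} {b} [] B _ b<s with b <? s
... | yes _   = refl
... | no b≮s = contradiction b<s b≮s
pickBelow-skipping {s} (a ∷ A) B (s≤a ∷ s≤A) b<s with a <? s
... | yes a<s = contradiction s≤a (<⇒≱ a<s)
... | no _ rewrite pickBelow-skipping A B s≤A b<s = refl

matchDesc-untouched : ∀ {p} (P : Pred ℕ p) ss {bs} A C rest → Pointwise _>_ ss bs → All P A → All P bs →
                      ∃₂ λ ms A′ → All P A′ × matchDesc (ss ++ rest) (A ++ bs ++ C) ≡ ms ++ matchDesc rest (A′ ++ C)
matchDesc-untouched P []       A C rest []               PA []         = [] , A , PA , refl
matchDesc-untouched P (s ∷ ss) {b ∷ bs} A C rest (b<s ∷ ss>bs) PA (Pb ∷ Pbs)
  with pickBelow-past P A (bs ++ C) PA Pb b<s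
... | t , A′ , PA′ , picked rewrite picked with matchDesc-untouched P ss A′ C rest ss>bs PA′ Pbs
...   | ms , A″ , PA″ , eq = t ∷ ms , A″ , PA″ , cong (t ∷_) eq

matchDesc-picks-partners : ∀ ss {bs} A → Pointwise _>_ ss bs → All (λ a → All (_≤ a) ss) A →
                           matchDesc ss (A ++ bs) ≡ bs
matchDesc-picks-partners []       A []            _  = refl
matchDesc-picks-partners (s ∷ ss) {b ∷ bs} A (b<s ∷ ss>bs) A≥
  rewrite pickBelow-skipping A bs (All.map All.head A≥) b<s =
  cong (b ∷_) (matchDesc-picks-partners ss A ss>bs (All.map All.tail A≥))

matchDesc-reverse-prefix : ∀ S₁ S₂ T₁ T₂ D → Pointwise _>_ S₁ T₁ → Pointwise _>_ S₂ T₂ →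
                           All (λ t → All (_≤ t) S₁) (T₂ ++ D) →
                           ∃ λ ms → matchDesc (reverse (S₁ ++ S₂)) (reverse (T₁ ++ T₂ ++ D)) ≡ ms ++ reverse T₁
matchDesc-reverse-prefix S₁ S₂ T₁ T₂ D S₁>T₁ S₂>T₂ S₁≤T₂D
  with ++⁻ T₂ (All.map All-reverse⁺ S₁≤T₂D)
... | S₁≤T₂ , S₁≤D
  with matchDesc-untouched (λ t → All (_≤ t) (reverse S₁)) (reverse S₂) (reverse D) (reverse T₁) (reverse S₁)
         (Pointwise.reverse⁺ S₂>T₂) (All-reverse⁺ S₁≤D) (All-reverse⁺ S₁≤T₂)
... | ms , A , S₁≤A , untouched = ms , (begin
  matchDesc (reverse (S₁ ++ S₂)) (reverse (T₁ ++ T₂ ++ D))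
    ≡⟨ cong₂ matchDesc (reverse-++ S₁ S₂) reverse-T₁T₂D ⟩
  matchDesc (reverse S₂ ++ reverse S₁) (reverse D ++ reverse T₂ ++ reverse T₁)
    ≡⟨ untouched ⟩
  ms ++ matchDesc (reverse S₁) (A ++ reverse T₁)
    ≡⟨ cong (ms ++_) (matchDesc-picks-partners (reverse S₁) A (Pointwise.reverse⁺ S₁>T₁) S₁≤A) ⟩
  ms ++ reverse T₁ ∎)
  where
  reverse-T₁T₂D : reverse (T₁ ++ T₂ ++ D) ≡ reverse D ++ reverse T₂ ++ reverse T₁
  reverse-T₁T₂D = begin
    reverse (T₁ ++ T₂ ++ D)                  ≡⟨ reverse-++ T₁ (T₂ ++ D) ⟩
    reverse (T₂ ++ D) ++ reverse T₁          ≡⟨ cong (_++ reverse T₁) (reverse-++ T₂ D) ⟩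
    (reverse D ++ reverse T₂) ++ reverse T₁  ≡⟨ ++-assoc (reverse D) (reverse T₂) (reverse T₁) ⟩
    reverse D ++ reverse T₂ ++ reverse T₁    ∎

◁-prefix : ∀ {T S} T₁ T₂ S₁ S₂ → T ⪯ S → T ≡ T₁ ++ T₂ → S ≡ S₁ ++ S₂ → length T₁ ≡ length S₁ →
           All (λ t → All (_≤ t) S₁) T₂ → ∀ {j} → j ≤ length T₁ → nth (T ◁ S) j ≡ nth T j
◁-prefix T₁ T₂ S₁ S₂ T⪯S refl refl |T₁|≡|S₁| S₁≤T₂ j≤
  with ⪯⇒Pointwise-prefix _ _ T⪯S
... | U , D , T₁T₂≡UD , S>U with Pointwise-++⁻ S₁ S>U
... | U₁ , U₂ , refl , S₁>U₁ , S₂>U₂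
  with ++-cancel-≡-length U₁ T₁ (trans (sym (Pointwise-length S₁>U₁)) (sym |T₁|≡|S₁|))
         (trans (sym (++-assoc U₁ U₂ D)) (sym T₁T₂≡UD))
... | refl , refl with matchDesc-reverse-prefix S₁ S₂ U₁ U₂ D S₁>U₁ S₂>U₂ S₁≤T₂
... | ms , matched = nth-filter-++ _ U₁ (U₂ ++ D) T₁⊆matched j≤
  where
  T₁⊆matched = All.tabulate (λ t∈ → subst (_ ∈_) (sym matched) (∈-++⁺ʳ ms (Any.reverse⁺ t∈)))

lemma4p9 : (T S : List ℕ) → IsFinPosSet T → IsFinPosSet S → T ⪯ S →
           (x : ℤ) → length (below T x) ≡ length (atMost S x) →
           (j : ℕ) → 1 ≤ j → j ≤ length (below T x) →
           nth (T ◁ S) j ≡ nth T j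
lemma4p9 T S T-set S-set T⪯S x |T<x|≡|S≤x| j _ j≤
  with filter-downClosed (λ t → + t ℤ.<? x) (λ a<b → ℤ.<-trans (+<+ a<b)) (IsFinPosSet.increasing T-set)
     | filter-downClosed (λ s → + s ℤ.≤? x) (λ a<b → ℤ.≤-trans (+≤+ (<⇒≤ a<b))) (IsFinPosSet.increasing S-set)
... | T₂ , T≡ , T₂≮x | S₂ , S≡ , _ =
  ◁-prefix (below T x) T₂ (atMost S x) S₂ T⪯S T≡ S≡ |T<x|≡|S≤x| (All.map atMost≤ T₂≮x) j≤
  where
  atMost≤ : ∀ {t} → ¬ (+ t ℤ.< x) → All (_≤ t) (atMost S x)
  atMost≤ t≮x = All.map (λ s≤x → ℤ.drop‿+≤+ (ℤ.≤-trans s≤x (ℤ.≮⇒≥ t≮x))) (all-filter _ S)
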